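{- Let $\mathcal{C}=(V,\mathcal{R})$ be a scheme, $X,Y\in\mathrm{Fib}(\mathcal{C})$ with $X\ne Y$, and $R,S\in\mathcal{R}_{X,Y}$ with $R\ne S$. Then there exists $T\in\mathcal{R}_Y$ with $T\ne\Delta_Y$ and $T\in R^tR\cap S^tS$ if and only if $c_{RS^t}^{T'}\ge 2$ for some $T'\in\mathcal{R}_X$.
   Context: A scheme is a pair $\mathcal{C}=(V,\mathcal{R})$, $V$ finite, $\mathcal{R}$ a partition of $V\times V$ into nonempty relations such that $\Delta_V$ is a union of members of $\mathcal{R}$, $\mathcal{R}$ is closed under transposition $R^t=\{(v,u):(u,v)\in R\}$, and for $R,S,T\in\mathcal{R}$ the number $c_{RS}^T$ of $w$ with $(u,w)\in R,(w,v)\in S$ is the same for all $(u,v)\in T$. A fiber is a nonempty $X\subseteq V$ with $\Delta_X\in\mathcal{R}$; $\mathcal{R}_{X,Y}=\{R\in\mathcal{R}:R\subseteq X\times Y\}$, $\mathcal{R}_X=\mathcal{R}_{X,X}$. The complex product is $RS=\{T\in\mathcal{R}:c_{RS}^T>0\}$. -}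

module Defs where

open import Data.Nat using (ℕ; zero; suc; _+_; _≤_; _<_)
open import Data.Fin using (Fin; zero; suc; _≟_)
open import Data.Product using (Σ; _×_; _,_; proj₁; proj₂)
open import Relation.Binary.PropositionalEquality using (_≡_)
open import Relation.Nullary using (Dec; yes; no; ¬_)

count : ∀ {n} → (P : Fin n → Set) → (∀ w → Dec (P w)) → ℕ
count {zero} P d = 0
count {suc n} P d with d zero
... | yes _ = suc (count (λ w → P (suc w)) (λ w → d (suc w)))
... | no  _ = count (λ w → P (suc w)) (λ w → d (suc w))

cnt : ∀ {n r} → (Fin n → Fin n → Fin r) → Fin r → Fin r → Fin n → Fin n → ℕ
cnt col R S u v = count (λ w → (col u w ≡ R) × (col w v ≡ S))
                        (λ w → dec (col u w ≟ R) (col w v ≟ S))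
  where
  dec : ∀ {A B : Set} → Dec A → Dec B → Dec (A × B)
  dec (yes a) (yes b) = yes (a , b)
  dec (no ¬a) _ = no (λ p → ¬a (proj₁ p))
  dec (yes _) (no ¬b) = no (λ p → ¬b (proj₂ p))

-- A scheme on V = Fin n whose relations are indexed by Fin r.
-- col u v is the (unique) relation containing (u , v); this encodes a
-- partition of V × V; rep gives a pair in each relation (nonemptiness).
record Scheme : Set where
  field
    n   : ℕ
    r   : ℕ
    col : Fin n → Fin n → Fin r
    rep : Fin r → Fin n × Fin n
    rep-ok : ∀ i → col (proj₁ (rep i)) (proj₂ (rep i)) ≡ i
    -- Δ_V is a union of relations: the relation of any (u,u) lies in Δ_V
    diag : ∀ u v w → col v w ≡ col u u → v ≡ w
    tr    : Fin r → Fin r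
    tr-ok : ∀ u v → col v u ≡ tr (col u v)
    -- intersection numbers are well defined
    regular : ∀ R S T u v → col u v ≡ T →
              cnt col R S u v ≡ cnt col R S (proj₁ (rep T)) (proj₂ (rep T))

  c : Fin r → Fin r → Fin r → ℕ
  c R S T = cnt col R S (proj₁ (rep T)) (proj₂ (rep T))

  _∈_·_ : Fin r → Fin r → Fin r → Set
  T ∈ R · S = 0 < c R S T

  -- the relation D is Δ_X for a fiber X = { u | col u u ≡ D }
  IsFiber : Fin r → Set
  IsFiber D = ∀ u v → col u v ≡ D → u ≡ v

  _∈F_ : Fin n → Fin r → Set
  u ∈F D = col u u ≡ D

  -- R ∈ 𝓡_{X,Y} where X, Y are given by their diagonal relations DX, DY
  In : Fin r → Fin r → Fin r → Set
  In DX DY R = ∀ u v → col u v ≡ R → (u ∈F DX) × (v ∈F DY)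

module Submission where

-- Read T = col y y′ with T ∈ RᵗR ∩ SᵗS.  Then a point x with a
-- path y –Rᵗ→ x –R→ y′ and a point x′ with y –Sᵗ→ x′ –S→ y′ give two
-- different middle points y ≠ y′ (different because T is not Δ_Y) of
-- R,Sᵗ-paths from x to x′; so c_{RSᵗ}^{T′} ≥ 2 for T′ = col x x′ ∈ 𝓡_X.
-- Conversely, two different middle points w₁ ≠ w₂ of R,Sᵗ-paths from x
-- to x′ show that T = col w₁ w₂ ∈ RᵗR (through x) and T ∈ SᵗS (through
-- x′); T ≠ Δ_Y since w₁ ≠ w₂, and T ∈ 𝓡_Y since w₁, w₂ ∈ Y.

open import Defs
open import Data.Nat using (suc; _≤_; _<_; s≤s; z≤n)
open import Data.Nat.Properties using (n≤1+n; ≤-refl; ≤-trans)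
open import Data.Fin using (Fin; zero; suc)
open import Data.Fin.Properties using (suc-injective)
open import Data.Product using (Σ; _×_; _,_; proj₁; proj₂)
open import Relation.Binary.PropositionalEquality
  using (_≡_; refl; sym; trans; cong; subst; module ≡-Reasoning)
open import Relation.Nullary using (¬_; Dec; yes; no)
open import Data.Empty using (⊥-elim)
open import Function.Bundles using (_⇔_; mk⇔)

Tail : ∀ {n} → (Fin (suc n) → Set) → Fin n → Set
Tail P w = P (suc w)

tail? : ∀ {n} {P : Fin (suc n) → Set} → (∀ w → Dec (P w)) → ∀ w → Dec (Tail P w)
tail? d w = d (suc w)

count-zero : ∀ {n} (P : Fin (suc n) → Set) (d : ∀ w → Dec (P w)) →
             P zero → count P d ≡ suc (count (Tail P) (tail? d))
count-zero P d p with d zero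
... | yes _ = refl
... | no ¬p = ⊥-elim (¬p p)

count-tail≤ : ∀ {n} (P : Fin (suc n) → Set) (d : ∀ w → Dec (P w)) →
              count (Tail P) (tail? d) ≤ count P d
count-tail≤ P d with d zero
... | yes _ = n≤1+n _
... | no _  = ≤-refl

count-pos : ∀ {n} (P : Fin n → Set) (d : ∀ w → Dec (P w)) (w : Fin n) →
            P w → 0 < count P d
count-pos P d zero p rewrite count-zero P d p = s≤s z≤n
count-pos P d (suc w) p = ≤-trans (count-pos (Tail P) (tail? d) w p) (count-tail≤ P d)

count-witness : ∀ {n} (P : Fin n → Set) (d : ∀ w → Dec (P w)) →
                0 < count P d → Σ (Fin n) P
count-witness {suc n} P d pos with d zero
... | yes p = zero , p
... | no _ with count-witness (Tail P) (tail? d) pos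
...   | w , p = suc w , p

count-≥2 : ∀ {n} (P : Fin n → Set) (d : ∀ w → Dec (P w)) (a b : Fin n) →
           ¬ (a ≡ b) → P a → P b → 2 ≤ count P d
count-≥2 P d zero zero a≢b _ _ = ⊥-elim (a≢b refl)
count-≥2 P d zero (suc b) _ pa pb
  rewrite count-zero P d pa = s≤s (count-pos (Tail P) (tail? d) b pb)
count-≥2 P d (suc a) zero _ pa pb
  rewrite count-zero P d pb = s≤s (count-pos (Tail P) (tail? d) a pa)
count-≥2 P d (suc a) (suc b) a≢b pa pb =
  ≤-trans (count-≥2 (Tail P) (tail? d) a b (λ a≡b → a≢b (cong suc a≡b)) pa pb)
          (count-tail≤ P d)

count-two-witnesses : ∀ {n} (P : Fin n → Set) (d : ∀ w → Dec (P w)) →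
  2 ≤ count P d → Σ (Fin n) λ a → Σ (Fin n) λ b → ¬ (a ≡ b) × P a × P b
count-two-witnesses {suc n} P d two with d zero
... | yes p with two
...   | s≤s pos with count-witness (Tail P) (tail? d) pos
...     | w , q = zero , suc w , (λ ()) , p , q
count-two-witnesses {suc n} P d two | no _
  with count-two-witnesses (Tail P) (tail? d) two
... | a , b , a≢b , pa , pb = suc a , suc b , (λ e → a≢b (suc-injective e)) , pa , pb

module SchemeFacts (𝓒 : Scheme) where
  open Scheme 𝓒

  Path : Fin r → Fin r → Fin n → Fin n → Fin n → Set
  Path R S u v w = (col u w ≡ R) × (col w v ≡ S)

  tr-involutive : ∀ R → tr (tr R) ≡ R
  tr-involutive R = begin
    tr (tr R)              ≡⟨ cong (λ Q → tr (tr Q)) (sym (rep-ok R)) ⟩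
    tr (tr (col x y))      ≡⟨ cong tr (sym (tr-ok x y)) ⟩
    tr (col y x)           ≡⟨ sym (tr-ok y x) ⟩
    col x y                ≡⟨ rep-ok R ⟩
    R                      ∎
    where
    open ≡-Reasoning
    x = proj₁ (rep R)
    y = proj₂ (rep R)

  flip : ∀ {u v R} → col u v ≡ R → col v u ≡ tr R
  flip {u} {v} uv = trans (tr-ok u v) (cong tr uv)

  flip⁻ : ∀ {u v R} → col u v ≡ tr R → col v u ≡ R
  flip⁻ {R = R} uv = trans (flip uv) (tr-involutive R)

  c-at : ∀ {R S T u v} → col u v ≡ T → c R S T ≡ cnt col R S u v
  c-at {R} {S} {T} {u} {v} uv = sym (regular R S T u v uv)

  ∈·-intro : ∀ {R S u v} w → Path R S u v w → col u v ∈ R · S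
  ∈·-intro {R} {S} w p = subst (0 <_) (sym (c-at refl)) (count-pos _ _ w p)

  ∈·-elim : ∀ {R S T} → T ∈ R · S →
            Σ (Fin n) (Path R S (proj₁ (rep T)) (proj₂ (rep T)))
  ∈·-elim T∈RS = count-witness _ _ T∈RS

  ≥2-intro : ∀ {R S u v} a b → ¬ (a ≡ b) → Path R S u v a → Path R S u v b →
             2 ≤ c R S (col u v)
  ≥2-intro a b a≢b pa pb = subst (2 ≤_) (sym (c-at refl)) (count-≥2 _ _ a b a≢b pa pb)

  ≥2-elim : ∀ {R S T} → 2 ≤ c R S T →
            Σ (Fin n) λ a → Σ (Fin n) λ b → ¬ (a ≡ b) ×
              Path R S (proj₁ (rep T)) (proj₂ (rep T)) a ×
              Path R S (proj₁ (rep T)) (proj₂ (rep T)) b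
  ≥2-elim two = count-two-witnesses _ _ two

  path-transfer : ∀ {R S u v x y} → col u v ≡ col x y →
                  Σ (Fin n) (Path R S x y) → Σ (Fin n) (Path R S u v)
  path-transfer {R} {S} {u} {v} {x} {y} uv≡xy (w , p) =
    count-witness _ _ (subst (0 <_) same-count (count-pos _ _ w p))
    where
    same-count : cnt col R S x y ≡ cnt col R S u v
    same-count = trans (sym (c-at refl)) (c-at uv≡xy)

  -- Pairs in the same relation have their endpoints in the same fibers:
  -- transfer the path x –Δ→ x → y (resp. x → y –Δ→ y) to (u,v); the
  -- diagonal relation only relates a point to itself.
  start-fiber : ∀ {u v x y} → col u v ≡ col x y → col u u ≡ col x x
  start-fiber {u} {x = x} uv≡xy with path-transfer uv≡xy (x , refl , refl)
  ... | w , uw , _ = subst (λ z → col u z ≡ col x x) (sym (diag x u w uw)) uw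

  end-fiber : ∀ {u v x y} → col u v ≡ col x y → col v v ≡ col y y
  end-fiber {v = v} {y = y} uv≡xy with path-transfer uv≡xy (y , refl , refl)
  ... | w , _ , wv = subst (λ z → col z v ≡ col y y) (diag y w v wv) wv

  col-In : ∀ {DX DY u v} → u ∈F DX → v ∈F DY → In DX DY (col u v)
  col-In u∈X v∈Y x y xy≡uv = trans (start-fiber xy≡uv) u∈X , trans (end-fiber xy≡uv) v∈Y

  off-diagonal : ∀ {D T u v} → In D D T → ¬ (T ≡ D) → col u v ≡ T → ¬ (u ≡ v)
  off-diagonal {u = u} T∈𝓡 T≢D uv refl = T≢D (trans (sym uv) (proj₁ (T∈𝓡 u u uv)))

  distinct-not-diagonal : ∀ {D u v} → u ∈F D → ¬ (u ≡ v) → ¬ (col u v ≡ D)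
  distinct-not-diagonal {u = u} {v} u∈D u≢v uv≡D = u≢v (diag u u v (trans uv≡D (sym u∈D)))

  shared-relation→double-path : ∀ {DX DY R S T} → In DX DY R → In DX DY S →
    In DY DY T → ¬ (T ≡ DY) → T ∈ tr R · R → T ∈ tr S · S →
    Σ (Fin r) (λ T′ → In DX DX T′ × (2 ≤ c R (tr S) T′))
  shared-relation→double-path {DX} {R = R} {T = T} R∈𝓡 S∈𝓡 T∈𝓡 T≢Δ T∈RᵗR T∈SᵗS
    with ∈·-elim T∈RᵗR | ∈·-elim T∈SᵗS
  ... | x , yx , xy′ | x′ , yx′ , x′y′ =
    col x x′ , col-In x∈X x′∈X ,
    ≥2-intro y y′ (off-diagonal T∈𝓡 T≢Δ (rep-ok T)) (xy , yx′) (xy′ , flip x′y′)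
    where
    y y′ : Fin n
    y  = proj₁ (rep T)
    y′ = proj₂ (rep T)
    xy : col x y ≡ R
    xy = flip⁻ yx
    x∈X : x ∈F DX
    x∈X = proj₁ (R∈𝓡 x y xy)
    x′∈X : x′ ∈F DX
    x′∈X = proj₁ (S∈𝓡 x′ y′ x′y′)

  double-path→shared-relation : ∀ {DX DY R S T′} → In DX DY R →
    2 ≤ c R (tr S) T′ →
    Σ (Fin r) (λ T → In DY DY T × ¬ (T ≡ DY) × (T ∈ tr R · R) × (T ∈ tr S · S))
  double-path→shared-relation {DY = DY} {T′ = T′} R∈𝓡 two with ≥2-elim two
  ... | w₁ , w₂ , w₁≢w₂ , (xw₁ , w₁x′) , (xw₂ , w₂x′) =
    col w₁ w₂ , col-In w₁∈Y w₂∈Y , distinct-not-diagonal w₁∈Y w₁≢w₂ ,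
    ∈·-intro x (flip xw₁ , xw₂) , ∈·-intro x′ (w₁x′ , flip⁻ w₂x′)
    where
    x x′ : Fin n
    x  = proj₁ (rep T′)
    x′ = proj₂ (rep T′)
    w₁∈Y : w₁ ∈F DY
    w₁∈Y = proj₂ (R∈𝓡 x w₁ xw₁)
    w₂∈Y : w₂ ∈F DY
    w₂∈Y = proj₂ (R∈𝓡 x w₂ xw₂)

lemma4 : (𝓒 : Scheme) → let open Scheme 𝓒 in
    (DX DY : Fin r) → IsFiber DX → IsFiber DY → ¬ (DX ≡ DY) →
    (R S : Fin r) → In DX DY R → In DX DY S → ¬ (R ≡ S) →
    (Σ (Fin r) (λ T → In DY DY T × ¬ (T ≡ DY) × (T ∈ tr R · R) × (T ∈ tr S · S)))
    ⇔ Σ (Fin r) (λ T′ → In DX DX T′ × (2 ≤ c R (tr S) T′))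
lemma4 𝓒 _ _ _ _ _ _ _ R∈𝓡 S∈𝓡 _ =
  mk⇔ (λ (T , T∈𝓡 , T≢Δ , T∈RᵗR , T∈SᵗS) →
         shared-relation→double-path R∈𝓡 S∈𝓡 T∈𝓡 T≢Δ T∈RᵗR T∈SᵗS)
      (λ (_ , _ , two) → double-path→shared-relation R∈𝓡 two)
  where open SchemeFacts 𝓒
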